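{- Let $d\ge 1$, let $p_1,\dots,p_{d-1}$ be nonnegative integers and $p_d\ge 2$ an integer. Let $\alpha=p_1+\cdots+p_{d-1}$ and $k=\left\lfloor\frac{p_d-2}{\alpha+1}\right\rfloor$, and let $T_{p_1\dots p_d}=\operatorname{conv}\{e_1,\dots,e_{d+1},(p_1,\dots,p_d,1)\}\subset\mathbb R^{d+1}$. Let $h=(a_1,\dots,a_{d+1})\in\mathbb Z^{d+1}$ be a primitive vector with $a_d=\pm1$ and $\operatorname{w}_h(T_{p_1\dots p_d})\le k+2$. Then $\operatorname{w}_h(T_{p_1\dots p_d})= k+2$.
   Context: $e_1,\dots,e_{d+1}$ is the standard basis of $\mathbb R^{d+1}$. An integer vector is primitive if the gcd of its entries is $1$. For a lattice polytope $P$ and an integer vector $h$, the lattice width of $P$ in direction $h$ is $\operatorname{w}_h(P)=\max_{x\in P}\langle h,x\rangle-\min_{x\in P}\langle h,x\rangle$, with $\langle\cdot,\cdot\rangle$ the standard inner product. -}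

module Defs where

open import Data.Nat as ℕ using (ℕ; zero; suc)
open import Data.Nat.GCD using (gcd)
open import Data.Integer using (ℤ; +_; _+_; _*_; _-_; _⊔_; _⊓_; ∣_∣)
open import Data.Fin using (Fin; _≟_)
open import Data.Vec using (Vec; []; _∷_; _∷ʳ_; map; zipWith; foldr; tabulate; toList)
open import Data.List as List using (List)
open import Relation.Nullary using (yes; no)
open import Relation.Binary.PropositionalEquality using (_≡_)

⟨_,_⟩ : ∀ {n} → Vec ℤ n → Vec ℤ n → ℤ
⟨ x , y ⟩ = foldr _ _+_ (+ 0) (zipWith _*_ x y)

e : ∀ {n} → Fin n → Vec ℤ n
e i = tabulate λ j → case? j
  where
  case? : _ → ℤ
  case? j with i ≟ j
  ... | yes _ = + 1
  ... | no _ = + 0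

Primitive : ∀ {n} → Vec ℤ n → Set
Primitive h = foldr _ gcd 0 (map ∣_∣ h) ≡ 1

-- lattice width in direction h of the convex hull of the nonempty finite
-- point set {v} ∪ vs : a linear functional attains its max/min over a
-- polytope at its vertices, so w_h(conv V) = max_V ⟨h,·⟩ − min_V ⟨h,·⟩.
widthConv : ∀ {n} → Vec ℤ n → Vec ℤ n → List (Vec ℤ n) → ℤ
widthConv h v vs =
  List.foldr _⊔_ ⟨ h , v ⟩ (List.map ⟨ h ,_⟩ vs)
  - List.foldr _⊓_ ⟨ h , v ⟩ (List.map ⟨ h ,_⟩ vs)

-- apex (p_1,…,p_{d-1},p_d,1) of T, with d = m+1
apex : ∀ {m} → Vec ℕ m → ℕ → Vec ℤ (suc (suc m))
apex ps pd = map +_ (ps ∷ʳ pd) ∷ʳ + 1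

widthT : ∀ {m} → Vec ℕ m → ℕ → Vec ℤ (suc (suc m)) → ℤ
widthT ps pd h = widthConv h (apex ps pd) (toList (tabulate e))

α : ∀ {m} → Vec ℕ m → ℕ
α ps = foldr _ ℕ._+_ 0 ps

kk : ∀ {m} → Vec ℕ m → ℕ → ℕ
kk ps pd = (pd ℕ.∸ 2) ℕ./ suc (α ps)

-- Suppose a_d = 1 and let v = (p_1,…,p_d,1) be the apex. Then
--   p_d + α = (⟨h,v⟩ − a_{d+1}) + Σ_{i<d} p_i (a_d − a_i),
-- a sum of 1 + α differences of values of ⟨h,·⟩ at vertices of T, each at most
-- the width w. So (1 + α) w ≥ p_d + α, i.e. w ≥ ⌈(p_d + α)/(1 + α)⌉, and for
-- p_d ≥ 2 this ceiling equals ⌊(p_d − 2)/(1 + α)⌋ + 2 = k + 2.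
-- The case a_d = −1 follows by replacing h with −h, which has the same width.
module Submission where

open import Defs
open import Data.Empty using (⊥-elim)
open import Data.Fin using (Fin; _≟_; fromℕ; inject₁) renaming (zero to fz; suc to fs)
open import Data.Integer as ℤ using (ℤ; +_; -_; _≤_; 0ℤ; 1ℤ; _-_; _⊔_; _⊓_)
import Data.Integer.Properties as ℤ
open import Data.Integer.Tactic.RingSolver using (solve-∀)
open import Data.List as List using (List; []; _∷_)
open import Data.List.Membership.Propositional using (_∈_)
open import Data.List.Membership.Propositional.Properties using (∈-map⁺)
open import Data.List.Relation.Unary.Any using (here; there)
open import Data.Nat as ℕ using (ℕ; suc; _≥_; _+_)
import Data.Nat.Properties as ℕ
open import Data.Nat.DivMod using (_/_; m/n*n≤m)
import Data.Nat.Tactic.RingSolver as NatSolver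
open import Data.Sum using (_⊎_; inj₁; inj₂)
open import Data.Vec using (Vec; lookup; []; _∷_; map; tabulate; toList)
open import Data.Vec.Membership.Propositional.Properties using (∈-tabulate⁺; ∈-toList⁺)
open import Data.Vec.Properties using (lookup∘tabulate; lookup-map)
open import Function.Base using (_∋_)
open import Relation.Nullary using (yes; no)
open import Relation.Binary.PropositionalEquality
  using (_≡_; _≢_; refl; sym; trans; cong; cong₂; subst; subst₂; module ≡-Reasoning)

-- Abstracting i ≟ j in the type of lookup∘tabulate exposes the case split inside e.
lookup-e-diag : ∀ {n} (i : Fin n) → lookup (e i) i ≡ 1ℤ
lookup-e-diag i with i ≟ i | (lookup (e i) i ≡ _ ∋ lookup∘tabulate _ i)
... | yes _    | eq = eq
... | no i≢i  | _  = ⊥-elim (i≢i refl)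

lookup-e-off-diag : ∀ {n} {i j : Fin n} → i ≢ j → lookup (e i) j ≡ 0ℤ
lookup-e-off-diag {i = i} {j} i≢j with i ≟ j | (lookup (e i) j ≡ _ ∋ lookup∘tabulate _ j)
... | yes i≡j | _  = ⊥-elim (i≢j i≡j)
... | no _    | eq = eq

⟨,⟩-zeroʳ : ∀ {n} (h v : Vec ℤ n) → (∀ j → lookup v j ≡ 0ℤ) → ⟨ h , v ⟩ ≡ 0ℤ
⟨,⟩-zeroʳ []      []      _    = refl
⟨,⟩-zeroʳ (a ∷ h) (b ∷ v) v≡0
  rewrite v≡0 fz | ℤ.*-zeroʳ a | ⟨,⟩-zeroʳ h v (λ j → v≡0 (fs j)) = refl

⟨,⟩-unitʳ : ∀ {n} (h v : Vec ℤ n) (i : Fin n) → lookup v i ≡ 1ℤ →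
            (∀ {j} → i ≢ j → lookup v j ≡ 0ℤ) → ⟨ h , v ⟩ ≡ lookup h i
⟨,⟩-unitʳ (a ∷ h) (b ∷ v) fz b≡1 off
  rewrite b≡1 | ℤ.*-identityʳ a | ⟨,⟩-zeroʳ h v (λ j → off {fs j} λ ()) = ℤ.+-identityʳ a
⟨,⟩-unitʳ (a ∷ h) (b ∷ v) (fs i) vᵢ≡1 off
  rewrite off {fz} (λ ()) | ℤ.*-zeroʳ a =
    trans (ℤ.+-identityˡ _) (⟨,⟩-unitʳ h v i vᵢ≡1 λ {j} i≢j → off {fs j} λ { refl → i≢j refl })

⟨,⟩-eʳ : ∀ {n} (h : Vec ℤ n) (i : Fin n) → ⟨ h , e i ⟩ ≡ lookup h i
⟨,⟩-eʳ h i = ⟨,⟩-unitʳ h (e i) i (lookup-e-diag i) lookup-e-off-diag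

⟨,⟩-negˡ : ∀ {n} (h v : Vec ℤ n) → ⟨ map -_ h , v ⟩ ≡ - ⟨ h , v ⟩
⟨,⟩-negˡ []      []      = refl
⟨,⟩-negˡ (a ∷ h) (b ∷ v) = begin
  - a ℤ.* b ℤ.+ ⟨ map -_ h , v ⟩ ≡⟨ cong₂ ℤ._+_ (sym (ℤ.neg-distribˡ-* a b)) (⟨,⟩-negˡ h v) ⟩
  - (a ℤ.* b) ℤ.+ - ⟨ h , v ⟩     ≡⟨ ℤ.neg-distrib-+ (a ℤ.* b) ⟨ h , v ⟩ ⟨
  - (a ℤ.* b ℤ.+ ⟨ h , v ⟩)       ∎
  where open ≡-Reasoning

∈⇒≤foldr-⊔ : ∀ {y z : ℤ} xs → y ∈ z ∷ xs → y ≤ List.foldr _⊔_ z xs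
∈⇒≤foldr-⊔ []       (here refl)         = ℤ.≤-refl
∈⇒≤foldr-⊔ (x ∷ xs) (here refl)         = ℤ.i≤j⇒i≤k⊔j x (∈⇒≤foldr-⊔ xs (here refl))
∈⇒≤foldr-⊔ (x ∷ xs) (there (here refl)) = ℤ.i≤i⊔j x _
∈⇒≤foldr-⊔ (x ∷ xs) (there (there y∈))  = ℤ.i≤j⇒i≤k⊔j x (∈⇒≤foldr-⊔ xs (there y∈))

∈⇒foldr-⊓≤ : ∀ {y z : ℤ} xs → y ∈ z ∷ xs → List.foldr _⊓_ z xs ≤ y
∈⇒foldr-⊓≤ []       (here refl)         = ℤ.≤-refl
∈⇒foldr-⊓≤ (x ∷ xs) (here refl)         = ℤ.i≤j⇒k⊓i≤j x (∈⇒foldr-⊓≤ xs (here refl))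
∈⇒foldr-⊓≤ (x ∷ xs) (there (here refl)) = ℤ.i⊓j≤i x _
∈⇒foldr-⊓≤ (x ∷ xs) (there (there y∈))  = ℤ.i≤j⇒k⊓i≤j x (∈⇒foldr-⊓≤ xs (there y∈))

WidthBound : ∀ {n} → Vec ℤ n → List (Vec ℤ n) → ℤ → Set
WidthBound h V W = ∀ {x y} → x ∈ V → y ∈ V → ⟨ h , x ⟩ - ⟨ h , y ⟩ ≤ W

widthConv-isWidthBound : ∀ {n} (h v : Vec ℤ n) vs → WidthBound h (v ∷ vs) (widthConv h v vs)
widthConv-isWidthBound h v vs x∈ y∈ =
  ℤ.+-mono-≤ (∈⇒≤foldr-⊔ _ (∈-map⁺ ⟨ h ,_⟩ x∈)) (ℤ.neg-mono-≤ (∈⇒foldr-⊓≤ _ (∈-map⁺ ⟨ h ,_⟩ y∈)))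

WidthBound-neg : ∀ {n} (h : Vec ℤ n) {V W} → WidthBound h V W → WidthBound (map -_ h) V W
WidthBound-neg h {W = W} bound {x} {y} x∈ y∈ = begin
  ⟨ map -_ h , x ⟩ - ⟨ map -_ h , y ⟩ ≡⟨ cong₂ _-_ (⟨,⟩-negˡ h x) (⟨,⟩-negˡ h y) ⟩
  - ⟨ h , x ⟩ - - ⟨ h , y ⟩           ≡⟨ -i--j≡j-i ⟨ h , x ⟩ ⟨ h , y ⟩ ⟩
  ⟨ h , y ⟩ - ⟨ h , x ⟩               ≤⟨ bound y∈ x∈ ⟩
  W                                   ∎
  where
  open ℤ.≤-Reasoning
  -i--j≡j-i : ∀ i j → - i - - j ≡ j - i
  -i--j≡j-i = solve-∀

⟨,⟩-apexʳ-≥ : ∀ {m} (ps : Vec ℕ m) pd (h : Vec ℤ (suc (suc m))) {L} → (∀ i → L ≤ lookup h i) →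
  + α ps ℤ.* L ℤ.+ (lookup h (inject₁ (fromℕ m)) ℤ.* + pd ℤ.+ lookup h (fromℕ (suc m)))
    ≤ ⟨ h , apex ps pd ⟩
⟨,⟩-apexʳ-≥ [] pd (a ∷ b ∷ []) {L} _ = ℤ.≤-reflexive (base L a b (+ pd))
  where
  base : ∀ L a b p → 0ℤ ℤ.* L ℤ.+ (a ℤ.* p ℤ.+ b) ≡ a ℤ.* p ℤ.+ (b ℤ.* 1ℤ ℤ.+ 0ℤ)
  base = solve-∀
⟨,⟩-apexʳ-≥ {suc m} (p ∷ ps) pd (a ∷ h) {L} L≤h = begin
  + (p + α ps) ℤ.* L ℤ.+ X             ≡⟨ cong (λ c → c ℤ.* L ℤ.+ X) (ℤ.pos-+ p (α ps)) ⟩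
  (+ p ℤ.+ + α ps) ℤ.* L ℤ.+ X         ≡⟨ split (+ p) (+ α ps) L X ⟩
  L ℤ.* + p ℤ.+ (+ α ps ℤ.* L ℤ.+ X)   ≤⟨ ℤ.+-mono-≤ (ℤ.*-monoʳ-≤-nonNeg (+ p) (L≤h fz))
                                                    (⟨,⟩-apexʳ-≥ ps pd h (λ i → L≤h (fs i))) ⟩
  a ℤ.* + p ℤ.+ ⟨ h , apex ps pd ⟩     ∎
  where
  open ℤ.≤-Reasoning
  X : ℤ
  X = lookup h (inject₁ (fromℕ m)) ℤ.* + pd ℤ.+ lookup h (fromℕ (suc m))
  split : ∀ p q L X → (p ℤ.+ q) ℤ.* L ℤ.+ X ≡ L ℤ.* p ℤ.+ (q ℤ.* L ℤ.+ X)
  split = solve-∀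

i-j≤k⇒i-k≤j : ∀ {i j k : ℤ} → i - j ≤ k → i - k ≤ j
i-j≤k⇒i-k≤j {i} {j} {k} i-j≤k = begin
  i - k                   ≡⟨ ℤ.+-minus-telescope i j k ⟨
  (i - j) ℤ.+ (j - k)     ≤⟨ ℤ.+-monoˡ-≤ (j - k) i-j≤k ⟩
  k ℤ.+ (j - k)           ≡⟨ k+[j-k]≡j k j ⟩
  j                       ∎
  where
  open ℤ.≤-Reasoning
  k+[j-k]≡j : ∀ k j → k ℤ.+ (j - k) ≡ j
  k+[j-k]≡j = solve-∀

module _ {m} (ps : Vec ℕ m) (pd : ℕ) where

  vertices : List (Vec ℤ (suc (suc m)))
  vertices = apex ps pd ∷ toList (tabulate e)

  e∈vertices : ∀ i → e i ∈ vertices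
  e∈vertices i = there (∈-toList⁺ (∈-tabulate⁺ e i))

  pd+α≤[1+α]*W : ∀ (h : Vec ℤ (suc (suc m))) {W} → lookup h (inject₁ (fromℕ m)) ≡ 1ℤ →
                 WidthBound h vertices W → + (pd + α ps) ≤ + suc (α ps) ℤ.* W
  pd+α≤[1+α]*W h {W} hd≡1 bound = begin
    + (pd + α ps)                                           ≡⟨ ℤ.pos-+ pd (α ps) ⟩
    + pd ℤ.+ a                                              ≡⟨ regroup a W (+ pd) b ⟩
    a ℤ.* (1ℤ - W) ℤ.+ (1ℤ ℤ.* + pd ℤ.+ b) - b ℤ.+ a ℤ.* W  ≤⟨ ℤ.+-monoˡ-≤ (a ℤ.* W) (ℤ.+-monoˡ-≤ (- b) apex≥) ⟩
    ⟨ h , apex ps pd ⟩ - b ℤ.+ a ℤ.* W                      ≤⟨ ℤ.+-monoˡ-≤ (a ℤ.* W) apex-last≤W ⟩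
    W ℤ.+ a ℤ.* W                                           ≡⟨ factor a W ⟩
    (1ℤ ℤ.+ a) ℤ.* W                                        ≡⟨ cong (ℤ._* W) (ℤ.pos-+ 1 (α ps)) ⟨
    + suc (α ps) ℤ.* W                                      ∎
    where
    open ℤ.≤-Reasoning
    a b : ℤ
    a = + α ps
    b = lookup h (fromℕ (suc m))
    1-W≤h : ∀ i → 1ℤ - W ≤ lookup h i
    1-W≤h i = i-j≤k⇒i-k≤j {1ℤ} (subst₂ (λ x y → x - y ≤ W) (trans (⟨,⟩-eʳ h _) hd≡1) (⟨,⟩-eʳ h i)
                (bound (e∈vertices (inject₁ (fromℕ m))) (e∈vertices i)))
    apex≥ : a ℤ.* (1ℤ - W) ℤ.+ (1ℤ ℤ.* + pd ℤ.+ b) ≤ ⟨ h , apex ps pd ⟩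
    apex≥ = subst (λ c → a ℤ.* (1ℤ - W) ℤ.+ (c ℤ.* + pd ℤ.+ b) ≤ ⟨ h , apex ps pd ⟩) hd≡1
              (⟨,⟩-apexʳ-≥ ps pd h 1-W≤h)
    apex-last≤W : ⟨ h , apex ps pd ⟩ - b ≤ W
    apex-last≤W = subst (λ y → ⟨ h , apex ps pd ⟩ - y ≤ W) (⟨,⟩-eʳ h _)
                    (bound (here refl) (e∈vertices (fromℕ (suc m))))
    regroup : ∀ a W p b → p ℤ.+ a ≡ a ℤ.* (1ℤ - W) ℤ.+ (1ℤ ℤ.* p ℤ.+ b) - b ℤ.+ a ℤ.* W
    regroup = solve-∀
    factor : ∀ a W → W ℤ.+ a ℤ.* W ≡ (1ℤ ℤ.+ a) ℤ.* W
    factor = solve-∀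

p+q≤[1+q]*W⇒[p∸2]/[1+q]+2≤W : ∀ p q {W : ℤ} → 2 ℕ.≤ p →
  + (p + q) ≤ + suc q ℤ.* W → + ((p ℕ.∸ 2) / suc q + 2) ≤ W
p+q≤[1+q]*W⇒[p∸2]/[1+q]+2≤W (suc (suc r)) q {W} (ℕ.s≤s (ℕ.s≤s _)) p+q≤[1+q]W =
  subst (_≤ W) (cong +_ (sym (ℕ.+-suc k 1))) (ℤ.i<j⇒suc[i]≤j (ℤ.*-cancelˡ-<-nonNeg (+ suc q) (begin-strict
    + suc q ℤ.* + (k + 1)   ≡⟨ ℤ.pos-* (suc q) (k + 1) ⟨
    + (suc q ℕ.* (k + 1))   <⟨ ℤ.+<+ [1+q][k+1]<2+r+q ⟩
    + (2 + r + q)           ≤⟨ p+q≤[1+q]W ⟩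
    + suc q ℤ.* W           ∎)))
  where
  k : ℕ
  k = r / suc q
  [1+q][k+1]<2+r+q : suc q ℕ.* (k + 1) ℕ.< 2 + r + q
  [1+q][k+1]<2+r+q = ℕ.s≤s (begin
    suc q ℕ.* (k + 1)       ≡⟨ distrib k (suc q) ⟩
    k ℕ.* suc q + suc q     ≤⟨ ℕ.+-monoˡ-≤ (suc q) (m/n*n≤m r (suc q)) ⟩
    r + suc q               ≡⟨ ℕ.+-suc r q ⟩
    suc (r + q)             ∎)
    where
    open ℕ.≤-Reasoning
    distrib : ∀ k n → n ℕ.* (k + 1) ≡ k ℕ.* n + n
    distrib = NatSolver.solve-∀
  open ℤ.≤-Reasoning

lemma3p3 : (m : ℕ) (ps : Vec ℕ m) (pd : ℕ) → pd ≥ 2 →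
    (h : Vec ℤ (suc (suc m))) → Primitive h →
    (lookup h (inject₁ (fromℕ m)) ≡ + 1 ⊎ lookup h (inject₁ (fromℕ m)) ≡ - (+ 1)) →
    widthT ps pd h ≤ + (kk ps pd + 2) →
    widthT ps pd h ≡ + (kk ps pd + 2)
lemma3p3 m ps pd pd≥2 h _ hd≡±1 w≤k+2 =
  ℤ.≤-antisym w≤k+2 (p+q≤[1+q]*W⇒[p∸2]/[1+q]+2≤W pd (α ps) pd≥2 (pd+α≤[1+α]*w hd≡±1))
  where
  w-bound : WidthBound h (vertices ps pd) (widthT ps pd h)
  w-bound = widthConv-isWidthBound h (apex ps pd) (toList (tabulate e))
  pd+α≤[1+α]*w : lookup h (inject₁ (fromℕ m)) ≡ + 1 ⊎ lookup h (inject₁ (fromℕ m)) ≡ - (+ 1) →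
                 + (pd + α ps) ≤ + suc (α ps) ℤ.* widthT ps pd h
  pd+α≤[1+α]*w (inj₁ hd≡1)  = pd+α≤[1+α]*W ps pd h hd≡1 w-bound
  pd+α≤[1+α]*w (inj₂ hd≡-1) = pd+α≤[1+α]*W ps pd (map -_ h)
    (trans (lookup-map (inject₁ (fromℕ m)) -_ h) (cong -_ hd≡-1)) (WidthBound-neg h w-bound)
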